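{- Let $d$ be a positive integer, let $\Gamma$ be a finite connected graph of valency at most $d$, and let $G\le\mathrm{Aut}(\Gamma)$ be transitive on $V\Gamma$. Suppose $G$ is a quasiprimitive permutation group on $V\Gamma$ of type HA, HS, HC or TW. Then $|G_\alpha|\le d!$ for every $\alpha\in V\Gamma$.
   Context: A permutation group is quasiprimitive if every non-identity normal subgroup is transitive. Types (Praeger's subdivision of finite quasiprimitive groups) relevant here: type HA means $G$ has an abelian minimal normal subgroup (which is then unique and regular); type HS means $G$ has exactly two minimal normal subgroups, each a non-abelian simple group acting regularly; type HC means $G$ has exactly two minimal normal subgroups, each isomorphic to $T^k$ with $T$ non-abelian simple and $k\ge2$, each acting regularly; type TW means $G$ has a unique minimal normal subgroup, which is non-abelian (isomorphic to $T^k$, $k\ge2$) and acts regularly. In all four types $G$ has a normal subgroup acting regularly on the point set. -}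

module Defs where

open import Level using (0ℓ)
open import Data.Nat using (ℕ; _≤_)
open import Data.Bool using (Bool; true; false)
open import Data.Fin using (Fin; _≟_)
open import Data.Vec using (Vec; lookup; tabulate)
open import Data.List using (List; length; filterᵇ; allFin)
open import Data.List.Membership.Propositional using (_∈_)
open import Data.List.Relation.Unary.All using (All)
open import Data.List.Relation.Unary.Unique.Propositional using (Unique)
open import Data.Product using (_×_; ∃-syntax; Σ-syntax)
open import Data.Sum using (_⊎_)
open import Relation.Nullary using (¬_)
open import Relation.Nullary.Decidable using (⌊_⌋)
open import Relation.Binary.PropositionalEquality using (_≡_)
open import Function using (id)
open import Function.Definitions using (Injective)
open import Algebra.Bundles using (Group)

-- Permutations of the finite point set Fin n, stored as the vector of
-- images (so equality of permutations is just _≡_).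

Perm : ℕ → Set
Perm n = Vec (Fin n) n

module _ {n : ℕ} where

  _·_ : Perm n → Fin n → Fin n
  g · x = lookup g x

  idₚ : Perm n
  idₚ = tabulate id

  _∘ₚ_ : Perm n → Perm n → Perm n
  g ∘ₚ h = tabulate (λ x → g · (h · x))

  IsPerm : Perm n → Set
  IsPerm g = Injective _≡_ _≡_ (g ·_)

record PermGroup (n : ℕ) : Set where
  field
    elems  : List (Perm n)
    unique : Unique elems
    perms  : All IsPerm elems
    id∈    : idₚ ∈ elems
    comp∈  : ∀ {g h} → g ∈ elems → h ∈ elems → (g ∘ₚ h) ∈ elems
    inv∈   : ∀ {g} → g ∈ elems → ∃[ h ] (h ∈ elems × (h ∘ₚ g) ≡ idₚ)
open PermGroup public

stabOrder : ∀ {n} → PermGroup n → Fin n → ℕ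
stabOrder G α = length (filterᵇ (λ g → ⌊ (g · α) ≟ α ⌋) (elems G))

-- Subgroups of Sym(n) given as predicates on permutations.

SubP : ℕ → Set₁
SubP n = Perm n → Set

module _ {n : ℕ} where

  ⟦_⟧ : PermGroup n → SubP n
  ⟦ G ⟧ g = g ∈ elems G

  _⊆ₛ_ : SubP n → SubP n → Set
  M ⊆ₛ N = ∀ {g} → M g → N g

  _≐_ : SubP n → SubP n → Set
  M ≐ N = (M ⊆ₛ N) × (N ⊆ₛ M)

  record IsSubgroupOf (H M : SubP n) : Set where
    field
      sub  : M ⊆ₛ H
      idM  : M idₚ
      comp : ∀ {g h} → M g → M h → M (g ∘ₚ h)
      inv  : ∀ {g} → M g → ∃[ h ] (M h × (h ∘ₚ g) ≡ idₚ)

  IsNormalIn : SubP n → SubP n → Set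
  IsNormalIn H M = IsSubgroupOf H M ×
    (∀ {g g′ h} → H g → (g′ ∘ₚ g) ≡ idₚ → M h → M ((g ∘ₚ h) ∘ₚ g′))

  Trivial : SubP n → Set
  Trivial M = ∀ g → M g → g ≡ idₚ

  IsMinimalNormalIn : SubP n → SubP n → Set₁
  IsMinimalNormalIn H N = IsNormalIn H N × ¬ Trivial N ×
    (∀ M → IsNormalIn H M → M ⊆ₛ N → ¬ Trivial M → N ⊆ₛ M)

  Abelian : SubP n → Set
  Abelian N = ∀ {g h} → N g → N h → (g ∘ₚ h) ≡ (h ∘ₚ g)

  IsSimple : SubP n → Set₁
  IsSimple N = ¬ Trivial N × (∀ M → IsNormalIn N M → ¬ Trivial M → N ⊆ₛ M)

  IsTransitive : SubP n → Set
  IsTransitive N = ∀ α β → ∃[ g ] (N g × g · α ≡ β)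

  IsRegular : SubP n → Set
  IsRegular N = IsTransitive N × (∀ g α → N g → g · α ≡ α → g ≡ idₚ)

  Quasiprimitive : PermGroup n → Set₁
  Quasiprimitive G = ∀ N → IsNormalIn ⟦ G ⟧ N → ¬ Trivial N → IsTransitive N

module _ (T : Group 0ℓ 0ℓ) where
  open Group T

  GroupNonAbelian : Set
  GroupNonAbelian = ¬ (∀ x y → (x ∙ y) ≈ (y ∙ x))

  record IsNormalSubgroupG (P : Carrier → Set) : Set where
    field
      resp : ∀ {x y} → x ≈ y → P x → P y
      εP   : P ε
      ∙P   : ∀ {x y} → P x → P y → P (x ∙ y)
      ⁻¹P  : ∀ {x} → P x → P (x ⁻¹)
      conj : ∀ {x y} → P y → P ((x ∙ y) ∙ (x ⁻¹))

  GroupSimple : Set₁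
  GroupSimple = ¬ (∀ x → x ≈ ε) ×
    (∀ P → IsNormalSubgroupG P → ¬ (∀ x → P x → x ≈ ε) → ∀ x → P x)

  -- N ≅ T^k  (T^k = Fin k → Carrier with pointwise operations)
  IsoToPower : ∀ {n} → SubP n → ℕ → Set
  IsoToPower {n} N k = Σ[ φ ∈ ((g : Perm n) → N g → (Fin k → Carrier)) ]
      ((∀ {g h} (p : N g) (q : N h) (r : N (g ∘ₚ h)) →
          ∀ i → φ (g ∘ₚ h) r i ≈ (φ g p i ∙ φ h q i))
    × (∀ {g h} (p : N g) (q : N h) → (∀ i → φ g p i ≈ φ h q i) → g ≡ h)
    × (∀ (x : Fin k → Carrier) → ∃[ g ] Σ[ p ∈ N g ] (∀ i → φ g p i ≈ x i)))

PowerOfNonAbelianSimple : ∀ {n} → SubP n → SubP n → Set₁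
PowerOfNonAbelianSimple M₁ M₂ = ∃[ T ] ∃[ k ]
  (2 ≤ k × GroupNonAbelian T × GroupSimple T × IsoToPower T M₁ k × IsoToPower T M₂ k)

module _ {n : ℕ} (G : PermGroup n) where

  TypeHA : Set₁
  TypeHA = ∃[ N ] (IsMinimalNormalIn ⟦ G ⟧ N × Abelian N)

  ExactlyTwoMinNormal : SubP n → SubP n → Set₁
  ExactlyTwoMinNormal M₁ M₂ = IsMinimalNormalIn ⟦ G ⟧ M₁ × IsMinimalNormalIn ⟦ G ⟧ M₂
    × ¬ (M₁ ≐ M₂) × (∀ M → IsMinimalNormalIn ⟦ G ⟧ M → (M ≐ M₁) ⊎ (M ≐ M₂))

  TypeHS : Set₁
  TypeHS = ∃[ M₁ ] ∃[ M₂ ] (ExactlyTwoMinNormal M₁ M₂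
    × ¬ Abelian M₁ × IsSimple M₁ × IsRegular M₁
    × ¬ Abelian M₂ × IsSimple M₂ × IsRegular M₂)

  TypeHC : Set₁
  TypeHC = ∃[ M₁ ] ∃[ M₂ ] (ExactlyTwoMinNormal M₁ M₂
    × PowerOfNonAbelianSimple M₁ M₂ × IsRegular M₁ × IsRegular M₂)

  TypeTW : Set₁
  TypeTW = ∃[ N ] (IsMinimalNormalIn ⟦ G ⟧ N
    × (∀ M → IsMinimalNormalIn ⟦ G ⟧ M → M ≐ N)
    × ¬ Abelian N × PowerOfNonAbelianSimple N N × IsRegular N)

record Graph (n : ℕ) : Set where
  field
    adj     : Fin n → Fin n → Bool
    symm    : ∀ v w → adj v w ≡ adj w v
    irrefl  : ∀ v → adj v v ≡ false
open Graph public

module _ {n : ℕ} (Γ : Graph n) where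

  data Walk : Fin n → Fin n → Set where
    here : ∀ {v} → Walk v v
    step : ∀ {u v w} → adj Γ u v ≡ true → Walk v w → Walk u w

  Connected : Set
  Connected = ∀ v w → Walk v w

  degree : Fin n → ℕ
  degree v = length (filterᵇ (adj Γ v) (allFin n))

  ValencyAtMost : ℕ → Set
  ValencyAtMost d = ∀ v → degree v ≤ d

  AutSubgroup : PermGroup n → Set
  AutSubgroup G = ∀ {g} → g ∈ elems G → ∀ v w → adj Γ (g · v) (g · w) ≡ adj Γ v w

module Submission where

-- If G ≤ Aut(Γ) has a normal subgroup N acting regularly on the vertices
-- and Γ is connected, then the point stabiliser G_α acts faithfully on the
-- neighbourhood Γ(α): for g, h ∈ G_α agreeing at a vertex u = m·α (m ∈ N),
-- the conjugates g m g⁻¹ and h m h⁻¹ lie in N and agree at α, hence are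
-- equal by regularity; from this g and h agree on every neighbour of u, and
-- by connectivity everywhere.  A faithful action on a set of at most d
-- points gives |G_α| ≤ d!.

open import Defs
open import Data.Nat using (ℕ; _≤_; _!)
open import Data.Fin using (Fin)
open import Data.Sum using (_⊎_)

open import Data.Nat using (zero; suc; _+_; _*_; z≤n; s≤s)
open import Data.Nat.Properties
  using (≤-refl; ≤-reflexive; ≤-trans; ≤-pred; +-mono-≤; +-suc; *-mono-≤; *-monoˡ-≤; 1≤n!; module ≤-Reasoning)
open import Data.Fin using (_≟_)
open import Data.Bool using (true; T?)
open import Data.Bool.Properties using (T-≡)
open import Data.List using (List; []; _∷_; length; filter; filterᵇ; allFin)
open import Data.List.Properties using (filter-notAll)
open import Data.List.Membership.Propositional using (_∈_)
open import Data.List.Membership.Propositional.Properties using (∈-filter⁺; ∈-filter⁻; ∈-allFin)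
open import Data.List.Relation.Unary.Any using (here; there)
import Data.List.Relation.Unary.Any as Any
import Data.List.Relation.Unary.All as All
open import Data.List.Relation.Unary.All using (_∷_)
open import Data.List.Relation.Unary.Unique.Propositional using (Unique)
open import Data.List.Relation.Unary.Unique.Propositional.Properties using (filter⁺; allFin⁺)
open import Data.List.Relation.Unary.AllPairs using (_∷_)
open import Data.Product using (_×_; _,_; proj₁; proj₂; ∃-syntax)
open import Data.Sum using (inj₁; inj₂)
open import Data.Empty using (⊥-elim)
open import Data.Vec.Properties using (lookup∘tabulate; tabulate∘lookup; tabulate-cong)
open import Function using (_∘_)
open import Function.Bundles using (Equivalence)
open import Function.Definitions using (Injective)
open import Relation.Nullary using (¬_; yes; no; ¬?)
open import Relation.Nullary.Decidable using (⌊_⌋; toWitness)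
open import Relation.Unary using (Decidable)
open import Relation.Unary.Properties using (∁?)
open import Relation.Binary.Definitions using (DecidableEquality)
open import Relation.Binary.PropositionalEquality
  using (_≡_; refl; sym; trans; cong; cong₂; subst; module ≡-Reasoning)

module _ {n : ℕ} where

  ·-∘ₚ : (g h : Perm n) (x : Fin n) → (g ∘ₚ h) · x ≡ g · (h · x)
  ·-∘ₚ g h x = lookup∘tabulate _ x

  ·-idₚ : (x : Fin n) → idₚ · x ≡ x
  ·-idₚ x = lookup∘tabulate _ x

  perm-ext : {g h : Perm n} → (∀ x → g · x ≡ h · x) → g ≡ h
  perm-ext {g} {h} same =
    trans (sym (tabulate∘lookup g)) (trans (tabulate-cong same) (tabulate∘lookup h))

  left-cancel : (h g : Perm n) → (h ∘ₚ g) ≡ idₚ → ∀ x → h · (g · x) ≡ x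
  left-cancel h g hg≡id x = trans (sym (·-∘ₚ h g x)) (trans (cong (_· x) hg≡id) (·-idₚ x))

  right-cancel : (h g : Perm n) → IsPerm h → (h ∘ₚ g) ≡ idₚ → ∀ x → g · (h · x) ≡ x
  right-cancel h g h-inj hg≡id x = h-inj (left-cancel h g hg≡id (h · x))

  conjugate-· : (g g′ m : Perm n) → (g′ ∘ₚ g) ≡ idₚ →
                ∀ x → ((g ∘ₚ m) ∘ₚ g′) · (g · x) ≡ g · (m · x)
  conjugate-· g g′ m g′g≡id x =
    trans (·-∘ₚ (g ∘ₚ m) g′ (g · x)) (trans (cong ((g ∘ₚ m) ·_) (left-cancel g′ g g′g≡id x)) (·-∘ₚ g m x))

!-mono : {m n : ℕ} → m ≤ n → m ! ≤ n !
!-mono {zero}  {n}     _         = 1≤n! n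
!-mono {suc m} {suc n} (s≤s m≤n) = *-mono-≤ (s≤s m≤n) (!-mono m≤n)

length-split : {A : Set} {P : A → Set} (P? : Decidable P) (L : List A) →
               length L ≤ length (filter P? L) + length (filter (∁? P?) L)
length-split P? []      = z≤n
length-split P? (x ∷ L) with P? x
... | yes _ = s≤s (length-split P? L)
... | no  _ = ≤-trans (s≤s (length-split P? L)) (≤-reflexive (sym (+-suc _ _)))

fibre-bound : {A B : Set} (_≟ᴮ_ : DecidableEquality B) (key : A → B) (k : ℕ)
  (T : List B) (L : List A) → Unique L → (∀ {x} → x ∈ L → key x ∈ T) →
  (∀ {t} → t ∈ T → (F : List A) → Unique F → (∀ {x} → x ∈ F → x ∈ L × key x ≡ t) → length F ≤ k) →
  length L ≤ length T * k
fibre-bound _≟ᴮ_ key k []      []      _    _    _      = z≤n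
fibre-bound _≟ᴮ_ key k []      (x ∷ L) _    keys _      with keys (here refl)
... | ()
fibre-bound _≟ᴮ_ key k (t ∷ T) L       uL   keys fibres = begin
  length L                                          ≤⟨ length-split over-t? L ⟩
  length (filter over-t? L) + length (filter (∁? over-t?) L)
    ≤⟨ +-mono-≤ (fibres (here refl) _ (filter⁺ over-t? uL) (∈-filter⁻ over-t?)) rest ⟩
  k + length T * k                                  ∎
  where
  open ≤-Reasoning
  over-t? : Decidable (λ x → key x ≡ t)
  over-t? x = key x ≟ᴮ t
  from-rest : ∀ {x} → x ∈ filter (∁? over-t?) L → x ∈ L
  from-rest = proj₁ ∘ ∈-filter⁻ (∁? over-t?)
  rest-keys : ∀ {x} → x ∈ filter (∁? over-t?) L → key x ∈ T
  rest-keys x∈ with ∈-filter⁻ (∁? over-t?) x∈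
  ... | x∈L , key≢t with keys x∈L
  ...   | here key≡t = ⊥-elim (key≢t key≡t)
  ...   | there key∈T = key∈T
  rest : length (filter (∁? over-t?) L) ≤ length T * k
  rest = fibre-bound _≟ᴮ_ key k T _ (filter⁺ (∁? over-t?) uL) rest-keys
    (λ t∈T F uF sub → fibres (there t∈T) F uF (λ x∈F → from-rest (proj₁ (sub x∈F)) , proj₂ (sub x∈F)))

-- Induct on S,
-- splitting the maps by the image of the first point.
module SeparatedMaps {F A B : Set} (_≟ᴮ_ : DecidableEquality B) (apply : F → A → B) where

  AllInjective : List F → Set
  AllInjective L = ∀ {f} → f ∈ L → Injective _≡_ _≡_ (apply f)

  MapsInto : List A → List B → List F → Set
  MapsInto S T L = ∀ {f x} → f ∈ L → x ∈ S → apply f x ∈ T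

  SeparatedBy : List A → List F → Set
  SeparatedBy S L = ∀ {f g} → f ∈ L → g ∈ L → (∀ {x} → x ∈ S → apply f x ≡ apply g x) → f ≡ g

  separated-by-nothing : (L : List F) → Unique L → SeparatedBy [] L → length L ≤ 1
  separated-by-nothing []            _                 _   = z≤n
  separated-by-nothing (f ∷ [])      _                 _   = s≤s z≤n
  separated-by-nothing (f ∷ g ∷ L)   ((f≢g ∷ _) ∷ _)   sep = ⊥-elim (f≢g (sep (here refl) (there (here refl)) λ ()))

  separated-bound : (S : List A) → Unique S → (T : List B) → length T ≤ length S →
    (L : List F) → Unique L → AllInjective L → MapsInto S T L → SeparatedBy S L →
    length L ≤ length S !
  separated-bound []      _           _ _    L uL _   _    sep = separated-by-nothing L uL sep
  separated-bound (s ∷ S) (s∉S ∷ uS) T |T|≤ L uL inj maps sep = begin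
    length L               ≤⟨ fibre-bound _≟ᴮ_ (λ f → apply f s) (length S !) T L uL
                                 (λ f∈ → maps f∈ (here refl)) fibre ⟩
    length T * length S !  ≤⟨ *-monoˡ-≤ (length S !) |T|≤ ⟩
    length (s ∷ S) !       ∎
    where
    open ≤-Reasoning
    -- The maps sending s to t send S into T ∖ {t}, and are separated by S.
    fibre : ∀ {t} → t ∈ T → (Fs : List F) → Unique Fs →
            (∀ {f} → f ∈ Fs → f ∈ L × apply f s ≡ t) → length Fs ≤ length S !
    fibre {t} t∈T Fs uFs sub = separated-bound S uS (filter other? T) smaller Fs uFs
      (λ f∈ → inj (proj₁ (sub f∈))) maps′ sep′
      where
      other? : Decidable (λ y → ¬ y ≡ t)
      other? y = ¬? (y ≟ᴮ t)
      smaller : length (filter other? T) ≤ length S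
      smaller = ≤-pred (≤-trans (filter-notAll other? T (Any.map (λ t≡y t≢y → t≢y (sym t≡y)) t∈T)) |T|≤)
      maps′ : MapsInto S (filter other? T) Fs
      maps′ {f} f∈ x∈ with sub f∈
      ... | f∈L , fs≡t = ∈-filter⁺ other? (maps f∈L (there x∈))
                           (λ fx≡t → All.lookup s∉S x∈ (inj f∈L (trans fs≡t (sym fx≡t))))
      sep′ : SeparatedBy S Fs
      sep′ f∈ g∈ agree with sub f∈ | sub g∈
      ... | f∈L , fs≡t | g∈L , gs≡t =
        sep f∈L g∈L λ { (here refl) → trans fs≡t (sym gs≡t) ; (there x∈) → agree x∈ }

module _ {n : ℕ} where

  Semiregular : SubP n → Set
  Semiregular N = ∀ g α → N g → g · α ≡ α → g ≡ idₚ

  semiregular-determined : {H N : SubP n} → (∀ {g} → H g → IsPerm g) → IsSubgroupOf H N →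
    Semiregular N → ∀ α {a b} → N a → N b → a · α ≡ b · α → a ≡ b
  semiregular-determined {H} {N} H-perm N≤H semireg α {a} {b} a∈N b∈N aα≡bα =
    perm-ext λ x → a′-inj (trans (left-cancel a′ a a′a≡id x) (sym (left-cancel a′ b a′b≡id x)))
    where
    open IsSubgroupOf N≤H
    a′ : Perm n
    a′ = proj₁ (inv a∈N)
    a′∈N : N a′
    a′∈N = proj₁ (proj₂ (inv a∈N))
    a′a≡id : (a′ ∘ₚ a) ≡ idₚ
    a′a≡id = proj₂ (proj₂ (inv a∈N))
    a′-inj : IsPerm a′
    a′-inj = H-perm (sub a′∈N)
    a′b≡id : (a′ ∘ₚ b) ≡ idₚ
    a′b≡id = semireg (a′ ∘ₚ b) α (comp a′∈N b∈N)
      (trans (·-∘ₚ a′ b α) (trans (cong (a′ ·_) (sym aα≡bα)) (left-cancel a′ a a′a≡id α)))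

  abelian-transitive-semiregular : {N : SubP n} → Abelian N → IsTransitive N → Semiregular N
  abelian-transitive-semiregular {N} ab trans-N g β g∈N gβ≡β = perm-ext λ x →
    let (m , m∈N , mβ≡x) = trans-N β x in begin
      g · x              ≡⟨ cong (g ·_) (sym mβ≡x) ⟩
      g · (m · β)        ≡⟨ sym (·-∘ₚ g m β) ⟩
      (g ∘ₚ m) · β       ≡⟨ cong (_· β) (ab g∈N m∈N) ⟩
      (m ∘ₚ g) · β       ≡⟨ ·-∘ₚ m g β ⟩
      m · (g · β)        ≡⟨ cong (m ·_) gβ≡β ⟩
      m · β              ≡⟨ mβ≡x ⟩
      x                  ≡⟨ sym (·-idₚ x) ⟩
      idₚ · x            ∎
    where open ≡-Reasoning

  HasRegularNormalSubgroup : PermGroup n → Set₁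
  HasRegularNormalSubgroup G = ∃[ N ] (IsNormalIn ⟦ G ⟧ N × IsRegular N)

  -- Each of the types HA, HS, HC, TW provides a regular normal subgroup; for
  -- HA the abelian minimal normal subgroup is transitive by quasiprimitivity.
  regular-normal-subgroup : (G : PermGroup n) → Quasiprimitive G →
    TypeHA G ⊎ TypeHS G ⊎ TypeHC G ⊎ TypeTW G → HasRegularNormalSubgroup G
  regular-normal-subgroup G qp (inj₁ (N , (N⊴G , N≢1 , _) , ab)) =
    N , N⊴G , transitive , abelian-transitive-semiregular ab transitive
    where
    transitive : IsTransitive N
    transitive = qp N N⊴G N≢1
  regular-normal-subgroup G qp (inj₂ (inj₁ (M₁ , _ , ((M₁⊴G , _) , _) , _ , _ , M₁-reg , _))) =
    M₁ , M₁⊴G , M₁-reg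
  regular-normal-subgroup G qp (inj₂ (inj₂ (inj₁ (M₁ , _ , ((M₁⊴G , _) , _) , _ , M₁-reg , _)))) =
    M₁ , M₁⊴G , M₁-reg
  regular-normal-subgroup G qp (inj₂ (inj₂ (inj₂ (N , (N⊴G , _) , _ , _ , _ , N-reg)))) =
    N , N⊴G , N-reg

module NeighbourhoodAction {n : ℕ} (Γ : Graph n) (G : PermGroup n) (aut : AutSubgroup Γ G)
  (N : SubP n) (N⊴G : IsNormalIn ⟦ G ⟧ N) (N-reg : IsRegular N) (α : Fin n) where

  open IsSubgroupOf (proj₁ N⊴G)

  G-perm : ∀ {g} → g ∈ elems G → IsPerm g
  G-perm = All.lookup (perms G)

  module _ {g h : Perm n} (g∈G : g ∈ elems G) (h∈G : h ∈ elems G)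
           (gα≡α : g · α ≡ α) (hα≡α : h · α ≡ α)
           (agree-Γα : ∀ s → adj Γ α s ≡ true → g · s ≡ h · s) where

    g′ h′ : Perm n
    g′ = proj₁ (inv∈ G g∈G)
    h′ = proj₁ (inv∈ G h∈G)

    g′g≡id : (g′ ∘ₚ g) ≡ idₚ
    g′g≡id = proj₂ (proj₂ (inv∈ G g∈G))

    h′h≡id : (h′ ∘ₚ h) ≡ idₚ
    h′h≡id = proj₂ (proj₂ (inv∈ G h∈G))

    -- If g and h agree at m·α (m ∈ N), then g m g⁻¹ = h m h⁻¹: both lie in
    -- N and send α to the same point.
    conjugates-agree : ∀ {m} → N m → g · (m · α) ≡ h · (m · α) →
                       ((g ∘ₚ m) ∘ₚ g′) ≡ ((h ∘ₚ m) ∘ₚ h′)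
    conjugates-agree {m} m∈N agree = semiregular-determined G-perm (proj₁ N⊴G) (proj₂ N-reg) α
      (proj₂ N⊴G {g′ = g′} g∈G g′g≡id m∈N) (proj₂ N⊴G {g′ = h′} h∈G h′h≡id m∈N) (begin
        ((g ∘ₚ m) ∘ₚ g′) · α        ≡⟨ cong (((g ∘ₚ m) ∘ₚ g′) ·_) (sym gα≡α) ⟩
        ((g ∘ₚ m) ∘ₚ g′) · (g · α)  ≡⟨ conjugate-· g g′ m g′g≡id α ⟩
        g · (m · α)                 ≡⟨ agree ⟩
        h · (m · α)                 ≡⟨ sym (conjugate-· h h′ m h′h≡id α) ⟩
        ((h ∘ₚ m) ∘ₚ h′) · (h · α)  ≡⟨ cong (((h ∘ₚ m) ∘ₚ h′) ·_) hα≡α ⟩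
        ((h ∘ₚ m) ∘ₚ h′) · α        ∎)
      where open ≡-Reasoning

    -- Agreement spreads along edges: write u = m·α with m ∈ N; a neighbour
    -- w of u is m·s for the neighbour s = m⁻¹·w of α.
    agree-step : ∀ {u w} → adj Γ u w ≡ true → g · u ≡ h · u → g · w ≡ h · w
    agree-step {u} {w} u~w gu≡hu = begin
      g · w                        ≡⟨ cong (g ·_) (sym ms≡w) ⟩
      g · (m · s)                  ≡⟨ sym (conjugate-· g g′ m g′g≡id s) ⟩
      ((g ∘ₚ m) ∘ₚ g′) · (g · s)   ≡⟨ cong₂ _·_ (conjugates-agree m∈N agree-mα) (agree-Γα s α~s) ⟩
      ((h ∘ₚ m) ∘ₚ h′) · (h · s)   ≡⟨ conjugate-· h h′ m h′h≡id s ⟩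
      h · (m · s)                  ≡⟨ cong (h ·_) ms≡w ⟩
      h · w                        ∎
      where
      open ≡-Reasoning
      m : Perm n
      m = proj₁ (proj₁ N-reg α u)
      m∈N : N m
      m∈N = proj₁ (proj₂ (proj₁ N-reg α u))
      mα≡u : m · α ≡ u
      mα≡u = proj₂ (proj₂ (proj₁ N-reg α u))
      m′ : Perm n
      m′ = proj₁ (inv m∈N)
      m′∈N : N m′
      m′∈N = proj₁ (proj₂ (inv m∈N))
      m′m≡id : (m′ ∘ₚ m) ≡ idₚ
      m′m≡id = proj₂ (proj₂ (inv m∈N))
      s : Fin n
      s = m′ · w
      ms≡w : m · s ≡ w
      ms≡w = right-cancel m′ m (G-perm (sub m′∈N)) m′m≡id w
      m′u≡α : m′ · u ≡ α
      m′u≡α = trans (cong (m′ ·_) (sym mα≡u)) (left-cancel m′ m m′m≡id α)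
      α~s : adj Γ α s ≡ true
      α~s = trans (cong (λ v → adj Γ v s) (sym m′u≡α)) (trans (aut (sub m′∈N) u w) u~w)
      agree-mα : g · (m · α) ≡ h · (m · α)
      agree-mα = subst (λ v → g · v ≡ h · v) (sym mα≡u) gu≡hu

    agree-walk : ∀ {u w} → Walk Γ u w → g · u ≡ h · u → g · w ≡ h · w
    agree-walk here         agree = agree
    agree-walk (step u~v p) agree = agree-walk p (agree-step u~v agree)

  Γα : List (Fin n)
  Γα = filterᵇ (adj Γ α) (allFin n)

  Gα : List (Perm n)
  Gα = filterᵇ (λ g → ⌊ (g · α) ≟ α ⌋) (elems G)

  ∈Gα⁻ : ∀ {f} → f ∈ Gα → f ∈ elems G × f · α ≡ α
  ∈Gα⁻ f∈ with ∈-filter⁻ (λ g → T? ⌊ (g · α) ≟ α ⌋) f∈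
  ... | f∈G , fixes = f∈G , toWitness fixes

  ∈Γα⁻ : ∀ {x} → x ∈ Γα → adj Γ α x ≡ true
  ∈Γα⁻ x∈ = Equivalence.to T-≡ (proj₂ (∈-filter⁻ (T? ∘ adj Γ α) {xs = allFin n} x∈))

  ∈Γα⁺ : ∀ {x} → adj Γ α x ≡ true → x ∈ Γα
  ∈Γα⁺ {x} α~x = ∈-filter⁺ (T? ∘ adj Γ α) (∈-allFin x) (Equivalence.from T-≡ α~x)

  -- |G_α| ≤ |Γ(α)|!: G_α maps Γ(α) to itself and is separated by Γ(α).
  stabiliser-bound : Connected Γ → stabOrder G α ≤ degree Γ α !
  stabiliser-bound connected =
    separated-bound Γα (filter⁺ _ (allFin⁺ n)) Γα ≤-refl Gα (filter⁺ _ (unique G))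
      (G-perm ∘ proj₁ ∘ ∈Gα⁻) preserves separated
    where
    open SeparatedMaps _≟_ _·_
    preserves : MapsInto Γα Γα Gα
    preserves {f} {x} f∈ x∈ with ∈Gα⁻ f∈
    ... | f∈G , fα≡α = ∈Γα⁺ (trans (cong (λ v → adj Γ v (f · x)) (sym fα≡α)) (trans (aut f∈G α x) (∈Γα⁻ x∈)))
    separated : SeparatedBy Γα Gα
    separated f∈ g∈ agree with ∈Gα⁻ f∈ | ∈Gα⁻ g∈
    ... | f∈G , fα≡α | g∈G , gα≡α = perm-ext λ v →
      agree-walk f∈G g∈G fα≡α gα≡α (λ s α~s → agree (∈Γα⁺ α~s)) (connected α v) (trans fα≡α (sym gα≡α))

corollary4p1 : (d : ℕ) → 1 ≤ d → (n : ℕ) (Γ : Graph n) → Connected Γ → ValencyAtMost Γ d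
    → (G : PermGroup n) → AutSubgroup Γ G → IsTransitive ⟦ G ⟧ → Quasiprimitive G
    → (TypeHA G ⊎ TypeHS G ⊎ TypeHC G ⊎ TypeTW G)
    → (α : Fin n) → stabOrder G α ≤ d !
corollary4p1 d _ n Γ connected valency G aut _ qp type α =
  let (N , N⊴G , N-reg) = regular-normal-subgroup G qp type in begin
    stabOrder G α   ≤⟨ NeighbourhoodAction.stabiliser-bound Γ G aut N N⊴G N-reg α connected ⟩
    degree Γ α !    ≤⟨ !-mono (valency α) ⟩
    d !             ∎
  where open ≤-Reasoning
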